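{- Let $\alpha$ be a non-zero algebraic number and let $R$ be a complete residue system of $\mathbb{Z}[\alpha]/\alpha\mathbb{Z}[\alpha]$. Let $J$ and $\wp$ be as defined in the context. Then the following are equivalent: (i) $\mathbb{Z}[\alpha]=R[\alpha]$; (ii) $\wp=\{J^{(n)}(0)\mid n\geq 0\}$, and for every $\beta\in\mathbb{Z}[\alpha]$ there exists $s=s(\beta)\in\mathbb{N}$ such that $J^{(s+1)}(\beta)=0$; (iii) $\wp=\{J^{(n)}(0)\mid n\geq 0\}$, and for every $\beta\in\mathbb{Z}[\alpha]$ the sequence $(J^{(n)}(\beta))_{n\geq 0}$ is eventually periodic.
   Context: A complete residue system (CRS) of $\mathbb{Z}[\alpha]/\alpha\mathbb{Z}[\alpha]$ is a subset $R\subset\mathbb{Z}[\alpha]$ containing exactly one element of each coset of $\alpha\mathbb{Z}[\alpha]$ in $\mathbb{Z}[\alpha]$. For $S\subset\mathbb{C}$, $S[\alpha]:=\{\sum_{j=0}^n f_j\alpha^j : n\in\mathbb{N},\ (f_0,\ldots,f_n)\in S^{n+1}\}$. The map $J:\mathbb{Z}[\alpha]\to\mathbb{Z}[\alpha]$ is $J(\beta)=(\beta-r)/\alpha$, where $r$ is the unique element of $R$ with $\beta-r\in\alpha\mathbb{Z}[\alpha]$; $J^{(0)}$ is the identity and $J^{(n+1)}=J\circ J^{(n)}$. The set $\wp$ of periodic elements is $\{\beta\in\mathbb{Z}[\alpha] : J^{(n)}(\beta)=\beta \text{ for some } n\geq 1\}$. -}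

module Defs where

open import Level using (Level; _⊔_)
open import Algebra.Bundles using (CommutativeRing)
open import Data.Nat as ℕ using (ℕ; zero; suc; _≤_)
open import Data.Integer as ℤ using (ℤ; +_; -[1+_])
open import Data.List using (List; []; _∷_)
open import Data.List.Relation.Unary.All using (All)
open import Data.List.Relation.Unary.Any using (Any)
open import Data.Product using (Σ; ∃; _×_)
open import Data.Sum using (_⊎_)
open import Relation.Nullary using (¬_)
open import Relation.Binary.PropositionalEquality using (_≢_)

-- Everything is relative to a commutative ring Rg (with setoid equality ≈),
-- which plays the role of ℤ[α].
module _ {c ℓ : Level} (Rg : CommutativeRing c ℓ) where
  open CommutativeRing Rg

  ιℕ : ℕ → Carrier
  ιℕ zero    = 0#
  ιℕ (suc n) = 1# + ιℕ n

  ιℤ : ℤ → Carrier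
  ιℤ (+ n)      = ιℕ n
  ιℤ -[1+ n ]   = - ιℕ (suc n)

  evalC : List Carrier → Carrier → Carrier
  evalC []       x = 0#
  evalC (f ∷ fs) x = f + x * evalC fs x

  evalℤ : List ℤ → Carrier → Carrier
  evalℤ []       x = 0#
  evalℤ (f ∷ fs) x = ιℤ f + x * evalℤ fs x

  IsIntegralDomain : Set (c ⊔ ℓ)
  IsIntegralDomain = (¬ (1# ≈ 0#)) × (∀ x y → x * y ≈ 0# → (x ≈ 0#) ⊎ (y ≈ 0#))

  CharZero : Set ℓ
  CharZero = ∀ n → ¬ (ιℕ (suc n) ≈ 0#)

  Algebraic : Carrier → Set ℓ
  Algebraic α = Σ (List ℤ) λ p → Any (λ a → a ≢ ℤ.0ℤ) p × evalℤ p α ≈ 0#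

  GeneratedBy : Carrier → Set (c ⊔ ℓ)
  GeneratedBy α = ∀ β → Σ (List ℤ) λ p → β ≈ evalℤ p α

  _∈αZ_ : Carrier → Carrier → Set (c ⊔ ℓ)
  x ∈αZ α = Σ Carrier λ y → x ≈ α * y

  _[_] : {r : Level} → (Carrier → Set r) → Carrier → Carrier → Set (c ⊔ ℓ ⊔ r)
  (S [ α ]) β = Σ (List Carrier) λ fs → All S fs × β ≈ evalC fs α

  IsCRS : {r : Level} → Carrier → (Carrier → Set r) → Set (c ⊔ ℓ ⊔ r)
  IsCRS α R =
    (∀ β → Σ Carrier λ t → R t × ((β - t) ∈αZ α)) ×
    (∀ t t' → R t → R t' → (t - t') ∈αZ α → t ≈ t')

  -- J is the map J(β) = (β - r)/α with r the element of R congruent to β,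
  -- i.e. β - r = α · J(β).
  IsJ : {r : Level} → Carrier → (Carrier → Set r) → (Carrier → Carrier) → Set (c ⊔ ℓ ⊔ r)
  IsJ α R J = ∀ β → Σ Carrier λ t → R t × (β - t ≈ α * J β)

  iter : (Carrier → Carrier) → ℕ → Carrier → Carrier
  iter J zero    β = β
  iter J (suc n) β = J (iter J n β)

  Periodic : (Carrier → Carrier) → Carrier → Set ℓ
  Periodic J β = Σ ℕ λ n → (1 ≤ n) × (iter J n β ≈ β)

  InOrbitOf0 : (Carrier → Carrier) → Carrier → Set ℓ
  InOrbitOf0 J β = Σ ℕ λ n → β ≈ iter J n 0#

  PeriodicIsOrbitOf0 : (Carrier → Carrier) → Set (c ⊔ ℓ)
  PeriodicIsOrbitOf0 J = ∀ β → (Periodic J β → InOrbitOf0 J β) × (InOrbitOf0 J β → Periodic J β)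

  EventuallyPeriodic : (Carrier → Carrier) → Carrier → Set ℓ
  EventuallyPeriodic J β =
    Σ ℕ λ m → Σ ℕ λ p → (1 ≤ p) × (∀ n → m ≤ n → iter J (p ℕ.+ n) β ≈ iter J n β)

  Cond-i : {r : Level} → Carrier → (Carrier → Set r) → Set (c ⊔ ℓ ⊔ r)
  Cond-i α R = ∀ β → (R [ α ]) β

  Cond-ii : (Carrier → Carrier) → Set (c ⊔ ℓ)
  Cond-ii J = PeriodicIsOrbitOf0 J × (∀ β → Σ ℕ λ s → iter J (suc s) β ≈ 0#)

  Cond-iii : (Carrier → Carrier) → Set (c ⊔ ℓ)
  Cond-iii J = PeriodicIsOrbitOf0 J × (∀ β → EventuallyPeriodic J β)

module Submission where

-- Proof idea.  All three conditions are equivalent to the single statement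
--
--     (Z)  every β ∈ ℤ[α] is eventually sent to 0 by J.
--
-- (i) ⇔ (Z) is digit expansion: β = t + α·J(β) with t ∈ R, and this is the
-- only way to write β as (digit) + α·(something), because R meets every coset
-- of αℤ[α] once and α can be cancelled in an integral domain.  So peeling
-- digits off β with J is exactly reading off an R-expansion of β, and the
-- expansion is finite iff the J-orbit of β reaches 0.
--
-- (ii) ⇔ (Z) and (iii) ⇔ (Z) only use the dynamics of a map J on a setoid:
-- under (Z) the point 0 is periodic (J(0) reaches 0 again), the orbit of a
-- periodic point is a cycle through it, and a point reaching a cycle is
-- eventually periodic.  Conversely, under (iii) every orbit ends in a cycle,
-- which is part of the orbit of 0 and hence passes through 0.

open import Defs
open import Level using (Level; _⊔_)
open import Algebra.Bundles using (CommutativeRing; AbelianGroup)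
open import Data.Nat as ℕ using (ℕ; zero; suc; s≤s; z≤n)
import Data.Nat.Properties as ℕₚ
open import Data.List using ([]; _∷_)
open import Data.List.Relation.Unary.All using (All; []; _∷_)
open import Data.Product using (_×_; _,_; proj₁; proj₂; Σ)
open import Data.Sum using (inj₁; inj₂)
open import Data.Empty using (⊥-elim)
open import Function.Bundles using (_⇔_; mk⇔)
open import Function.Construct.Composition using (_⇔-∘_)
open import Function.Construct.Symmetry using (⇔-sym)
open import Relation.Nullary using (¬_)
import Relation.Binary.PropositionalEquality as P
import Relation.Binary.Reasoning.Setoid as SetoidReasoning

module AbelianGroupFacts {a ℓ : Level} (G : AbelianGroup a ℓ) where
  open AbelianGroup G
  open import Algebra.Properties.AbelianGroup G
  open SetoidReasoning setoid

  split : ∀ x t → x ≈ t ∙ (x - t)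
  split x t = trans (sym (//-rightDividesˡ t x)) (comm (x - t) t)

  add-sub : ∀ t y → (t ∙ y) - t ≈ y
  add-sub t y = trans (∙-congʳ (comm t y)) (//-rightDividesʳ t y)

  sub-sub : ∀ x f t → (x - f) - (x - t) ≈ t - f
  sub-sub x f t = begin
    (x - f) - (x - t)     ≈⟨ ∙-congˡ (⁻¹-anti-homo‿- x t) ⟩
    (x - f) ∙ (t - x)     ≈⟨ comm (x - f) (t - x) ⟩
    (t - x) ∙ (x - f)     ≈⟨ assoc t (x ⁻¹) (x - f) ⟩
    t ∙ (x ⁻¹ ∙ (x - f))  ≈⟨ ∙-congˡ (\\-leftDividesʳ x (f ⁻¹)) ⟩
    t - f                 ∎

module Dynamics {c ℓ : Level} (Rg : CommutativeRing c ℓ)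
  (J : CommutativeRing.Carrier Rg → CommutativeRing.Carrier Rg)
  (J-cong : ∀ {x y} → CommutativeRing._≈_ Rg x y → CommutativeRing._≈_ Rg (J x) (J y))
  where

  open CommutativeRing Rg using (Carrier; _≈_; 0#; setoid; refl; sym; trans)
  open SetoidReasoning setoid

  iter-+ : ∀ m n x → iter Rg J (m ℕ.+ n) x P.≡ iter Rg J m (iter Rg J n x)
  iter-+ zero    n x = P.refl
  iter-+ (suc m) n x = P.cong J (iter-+ m n x)

  iter-comm : ∀ m n x → iter Rg J m (iter Rg J n x) P.≡ iter Rg J n (iter Rg J m x)
  iter-comm m n x = P.trans (P.sym (iter-+ m n x))
    (P.trans (P.cong (λ k → iter Rg J k x) (ℕₚ.+-comm m n)) (iter-+ n m x))

  iter-cong : ∀ n {x y} → x ≈ y → iter Rg J n x ≈ iter Rg J n y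
  iter-cong zero    x≈y = x≈y
  iter-cong (suc n) x≈y = J-cong (iter-cong n x≈y)

  infix 4 _↝_
  _↝_ : Carrier → Carrier → Set ℓ
  x ↝ y = Σ ℕ λ n → iter Rg J n x ≈ y

  ↝-trans : ∀ {x y z} → x ↝ y → y ↝ z → x ↝ z
  ↝-trans {x} {y} {z} (m , xy) (n , yz) = n ℕ.+ m , (begin
    iter Rg J (n ℕ.+ m) x        ≡⟨ iter-+ n m x ⟩
    iter Rg J n (iter Rg J m x)  ≈⟨ iter-cong n xy ⟩
    iter Rg J n y                ≈⟨ yz ⟩
    z                            ∎)

  period-spreads : ∀ p {x y} → iter Rg J p x ≈ x → x ↝ y → iter Rg J p y ≈ y
  period-spreads p {x} {y} px≈x (n , xy) = begin
    iter Rg J p y                ≈⟨ iter-cong p xy ⟨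
    iter Rg J p (iter Rg J n x)  ≡⟨ iter-comm p n x ⟩
    iter Rg J n (iter Rg J p x)  ≈⟨ iter-cong n px≈x ⟩
    iter Rg J n x                ≈⟨ xy ⟩
    y                            ∎

  periodic-returns : ∀ {x y} → Periodic Rg J x → x ↝ y → y ↝ x
  periodic-returns {x} {y} (suc q , _ , period) (n , xy) = n ℕ.* q , (begin
    iter Rg J (n ℕ.* q) y                ≈⟨ iter-cong (n ℕ.* q) xy ⟨
    iter Rg J (n ℕ.* q) (iter Rg J n x)  ≡⟨ iter-+ (n ℕ.* q) n x ⟨
    iter Rg J (n ℕ.* q ℕ.+ n) x          ≡⟨ P.cong (λ k → iter Rg J k x) n*q+n≡n*[1+q] ⟩
    iter Rg J (n ℕ.* suc q) x            ≈⟨ iterate-period n ⟩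
    x                                    ∎)
    where
    n*q+n≡n*[1+q] : n ℕ.* q ℕ.+ n P.≡ n ℕ.* suc q
    n*q+n≡n*[1+q] = P.trans (ℕₚ.+-comm (n ℕ.* q) n) (P.sym (ℕₚ.*-suc n q))

    iterate-period : ∀ k → iter Rg J (k ℕ.* suc q) x ≈ x
    iterate-period zero    = refl
    iterate-period (suc k) = begin
      iter Rg J (suc q ℕ.+ k ℕ.* suc q) x              ≡⟨ iter-+ (suc q) (k ℕ.* suc q) x ⟩
      iter Rg J (suc q) (iter Rg J (k ℕ.* suc q) x)    ≈⟨ iter-cong (suc q) (iterate-period k) ⟩
      iter Rg J (suc q) x                              ≈⟨ period ⟩
      x                                                ∎

  reach-in-positive-time : ∀ {x y} → Periodic Rg J y → x ↝ y →
                           Σ ℕ λ s → iter Rg J (suc s) x ≈ y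
  reach-in-positive-time (suc q , _ , period) x↝y =
    q ℕ.+ proj₁ x↝y , proj₂ (↝-trans x↝y (suc q , period))

  eventually-periodic : ∀ {x y} → x ↝ y → Periodic Rg J y → EventuallyPeriodic Rg J x
  eventually-periodic {x} {y} (s , xy) (p , 1≤p , period) = s , p , 1≤p , λ n s≤n → begin
    iter Rg J (p ℕ.+ n) x          ≡⟨ iter-+ p n x ⟩
    iter Rg J p (iter Rg J n x)    ≈⟨ period-spreads p period (y↝xₙ n s≤n) ⟩
    iter Rg J n x                  ∎
    where
    y↝xₙ : ∀ n → s ℕ.≤ n → y ↝ iter Rg J n x
    y↝xₙ n s≤n = n ℕ.∸ s , (begin
      iter Rg J (n ℕ.∸ s) y                  ≈⟨ iter-cong (n ℕ.∸ s) xy ⟨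
      iter Rg J (n ℕ.∸ s) (iter Rg J s x)    ≡⟨ iter-+ (n ℕ.∸ s) s x ⟨
      iter Rg J (n ℕ.∸ s ℕ.+ s) x            ≡⟨ P.cong (λ k → iter Rg J k x) (ℕₚ.m∸n+n≡m s≤n) ⟩
      iter Rg J n x                          ∎)

  AllReachZero : Set (c ⊔ ℓ)
  AllReachZero = ∀ β → β ↝ 0#

  -- under (Z), J(0) leads back to 0, so 0 lies on a cycle
  zero-periodic : AllReachZero → Periodic Rg J 0#
  zero-periodic reach = let (n , e) = reach (J 0#)
                        in suc n , s≤s z≤n , P.subst (_≈ 0#) (iter-comm n 1 0#) e

  orbit-is-↝ : ∀ {β} → InOrbitOf0 Rg J β → 0# ↝ β
  orbit-is-↝ (n , e) = n , sym e

  periodic-is-orbit : Periodic Rg J 0# → (∀ β → Periodic Rg J β → β ↝ 0#) →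
                      PeriodicIsOrbitOf0 Rg J
  periodic-is-orbit (q , 1≤q , period) reach β =
    (λ per → let (n , e) = periodic-returns per (reach β per) in n , sym e) ,
    (λ orb → q , 1≤q , period-spreads q period (orbit-is-↝ orb))

  -- (Z) ⇒ (ii): 0 is periodic, so ℘ is its orbit and 0 is reached in ≥ 1 steps
  reach⇒ii : AllReachZero → Cond-ii Rg J
  reach⇒ii reach = periodic-is-orbit (zero-periodic reach) (λ β _ → reach β) ,
                   λ β → reach-in-positive-time (zero-periodic reach) (reach β)

  ii⇔reach : Cond-ii Rg J ⇔ AllReachZero
  ii⇔reach = mk⇔ (λ (_ , reach) β → let (s , e) = reach β in suc s , e) reach⇒ii

  -- under (iii), the cycle an orbit ends in belongs to the orbit of 0, so contains 0
  iii⇒reach : Cond-iii Rg J → AllReachZero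
  iii⇒reach (℘≡orbit , ultimately) β =
    let (m , p , 1≤p , e) = ultimately β
        βₘ-periodic : Periodic Rg J (iter Rg J m β)
        βₘ-periodic = p , 1≤p , P.subst (_≈ iter Rg J m β) (iter-+ p m β) (e m ℕₚ.≤-refl)
        zero-per : Periodic Rg J 0#
        zero-per = proj₂ (℘≡orbit 0#) (0 , refl)
        0↝βₘ : 0# ↝ iter Rg J m β
        0↝βₘ = orbit-is-↝ (proj₁ (℘≡orbit (iter Rg J m β)) βₘ-periodic)
    in ↝-trans (m , refl) (periodic-returns zero-per 0↝βₘ)

  -- (Z) ⇒ (iii): every orbit runs into the cycle through 0
  iii⇔reach : Cond-iii Rg J ⇔ AllReachZero
  iii⇔reach = mk⇔ iii⇒reach
    (λ reach → proj₁ (reach⇒ii reach) ,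
               λ β → eventually-periodic (reach β) (zero-periodic reach))

module Digits {c ℓ r : Level} (Rg : CommutativeRing c ℓ) (dom : IsIntegralDomain Rg)
  (α : CommutativeRing.Carrier Rg) (α≉0 : ¬ (CommutativeRing._≈_ Rg α (CommutativeRing.0# Rg)))
  (R : CommutativeRing.Carrier Rg → Set r) (crs : IsCRS Rg α R)
  (J : CommutativeRing.Carrier Rg → CommutativeRing.Carrier Rg) (isJ : IsJ Rg α R J)
  where

  open CommutativeRing Rg
  open SetoidReasoning setoid
  open import Algebra.Properties.Ring ring using (x[y-z]≈xy-xz)
  open import Algebra.Properties.AbelianGroup +-abelianGroup using (x≈y⇒x∙y⁻¹≈ε; x∙y⁻¹≈ε⇒x≈y)
  open AbelianGroupFacts +-abelianGroup

  cancel-α : ∀ {x y} → α * x ≈ α * y → x ≈ y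
  cancel-α {x} {y} αx≈αy with proj₂ dom α (x - y) α[x-y]≈0
    where
    α[x-y]≈0 : α * (x - y) ≈ 0#
    α[x-y]≈0 = trans (x[y-z]≈xy-xz α x y) (x≈y⇒x∙y⁻¹≈ε αx≈αy)
  ... | inj₁ α≈0   = ⊥-elim (α≉0 α≈0)
  ... | inj₂ x-y≈0 = x∙y⁻¹≈ε⇒x≈y x y x-y≈0

  J-unique : ∀ {β f y} → R f → β - f ≈ α * y → J β ≈ y
  J-unique {β} {f} {y} Rf β-f≈αy = cancel-α (begin
    α * J β   ≈⟨ β-t≈αJβ ⟨
    β - t     ≈⟨ +-congˡ (-‿cong t≈f) ⟩
    β - f     ≈⟨ β-f≈αy ⟩
    α * y     ∎)
    where
    t : Carrier
    t = proj₁ (isJ β)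
    β-t≈αJβ : β - t ≈ α * J β
    β-t≈αJβ = proj₂ (proj₂ (isJ β))
    t-f∈αZ : _∈αZ_ Rg (t - f) α
    t-f∈αZ = y - J β , (begin
      t - f                ≈⟨ sub-sub β f t ⟨
      (β - f) - (β - t)    ≈⟨ +-cong β-f≈αy (-‿cong β-t≈αJβ) ⟩
      α * y - α * J β      ≈⟨ x[y-z]≈xy-xz α y (J β) ⟨
      α * (y - J β)        ∎)
    t≈f : t ≈ f
    t≈f = proj₂ crs t f (proj₁ (proj₂ (isJ β))) Rf t-f∈αZ

  -- J is well defined on ≈-classes, as a consequence of uniqueness of digits
  J-cong : ∀ {x y} → x ≈ y → J x ≈ J y
  J-cong {x} {y} x≈y = let (t , Rt , y-t≈αJy) = isJ y
                       in J-unique Rt (trans (+-congʳ x≈y) y-t≈αJy)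

  open Dynamics Rg J J-cong

  digit-split : ∀ β → Σ Carrier λ t → R t × β ≈ t + α * J β
  digit-split β = let (t , Rt , β-t≈αJβ) = isJ β
                  in t , Rt , trans (split β t) (+-congˡ β-t≈αJβ)

  expansion⇒reach : ∀ {fs} → All R fs → ∀ {β} → β ≈ evalC Rg fs α → β ↝ 0#
  expansion⇒reach []          β≈0 = 0 , β≈0
  expansion⇒reach {f ∷ fs} (Rf ∷ Rfs) {β} β≈f+αz =
    ↝-trans (1 , refl) (expansion⇒reach Rfs (J-unique Rf β-f≈αz))
    where
    β-f≈αz : β - f ≈ α * evalC Rg fs α
    β-f≈αz = trans (+-congʳ β≈f+αz) (add-sub f (α * evalC Rg fs α))

  reach⇒expansion : ∀ n β → iter Rg J n β ≈ 0# → _[_] Rg R α β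
  reach⇒expansion zero    β β≈0 = [] , [] , β≈0
  reach⇒expansion (suc n) β Jⁿ⁺¹β≈0 =
    let (t , Rt , β≈t+αJβ) = digit-split β
        (fs , Rfs , Jβ≈) = reach⇒expansion n (J β)
                             (P.subst (_≈ 0#) (iter-comm 1 n β) Jⁿ⁺¹β≈0)
    in t ∷ fs , Rt ∷ Rfs , trans β≈t+αJβ (+-congˡ (*-congˡ Jβ≈))

  i⇔reach : Cond-i Rg α R ⇔ AllReachZero
  i⇔reach = mk⇔ (λ ci β → from-expansion (ci β)) (λ reach β → to-expansion (reach β))
    where
    from-expansion : ∀ {β} → _[_] Rg R α β → β ↝ 0#
    from-expansion (_ , Rfs , β≈) = expansion⇒reach Rfs β≈
    to-expansion : ∀ {β} → β ↝ 0# → _[_] Rg R α β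
    to-expansion (n , Jⁿβ≈0) = reach⇒expansion n _ Jⁿβ≈0

proposition1 : {c ℓ r : Level} (Rg : CommutativeRing c ℓ) →
    IsIntegralDomain Rg → CharZero Rg →
    (α : CommutativeRing.Carrier Rg) →
    ¬ (CommutativeRing._≈_ Rg α (CommutativeRing.0# Rg)) →
    Algebraic Rg α → GeneratedBy Rg α →
    (R : CommutativeRing.Carrier Rg → Set r) → IsCRS Rg α R →
    (J : CommutativeRing.Carrier Rg → CommutativeRing.Carrier Rg) → IsJ Rg α R J →
    (Cond-i Rg α R ⇔ Cond-ii Rg J) × (Cond-ii Rg J ⇔ Cond-iii Rg J)
proposition1 Rg dom _ α α≉0 _ _ R crs J isJ =
  ⇔-sym ii⇔reach ⇔-∘ i⇔reach ,
  ⇔-sym iii⇔reach ⇔-∘ ii⇔reach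
  where
  open Digits Rg dom α α≉0 R crs J isJ using (J-cong; i⇔reach)
  open Dynamics Rg J J-cong using (ii⇔reach; iii⇔reach)
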